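{- Let $D$ be a finite directed graph with $n$ vertices having two distinct complete sources $c$ and $c'$. Then $\Delta(D)$ is the union of the subcomplexes $S_T$, where $T$ ranges over all rooted spanning directed trees of $D$ in which $c$ is a leaf.
   Context: A directed tree with root $r$ is an acyclic directed graph $T$ such that for every vertex $x$ there is a unique directed path from $r$ to $x$; a directed forest is a family of vertex-disjoint directed trees; a leaf of a directed tree is a non-root vertex with no outgoing edges. For a directed graph $D$, $\Delta(D)$ is the simplicial complex whose vertices are the directed edges of $D$ and whose faces are the edge sets of directed forests that are subgraphs of $D$. A vertex $c$ is a complete source of $D$ if $\overrightarrow{cy}\in E(D)$ for every vertex $y\neq c$. For a rooted spanning directed tree $T$ of $D$ in which $c$ is a leaf, let $x_1\to x_2\to\dots\to x_k\to c$ be the directed path in $T$ from the root $x_1$ to $c$, let $\sigma_T$ be the simplex $\{\overrightarrow{x_1x_2},\dots,\overrightarrow{x_{k-1}x_k},\overrightarrow{x_kc},\overrightarrow{cx_1}\}$ with boundary complex $\partial\sigma_T$ (all proper subsets), let $\{y_1,\dots,y_r\}=V(D)\setminus\{x_1,\dots,x_k,c\}$, and for each $y_i$ let $z_i$ be the unique vertex with $\overrightarrow{z_iy_i}\in E(T)$. Define $S_T=\partial\sigma_T*\{\overrightarrow{z_1y_1},\overrightarrow{cy_1}\}*\cdots*\{\overrightarrow{z_ry_r},\overrightarrow{cy_r}\}$, where $\{a,b\}$ denotes the $0$-dimensional complex with two vertices $a,b$ and $*$ is the simplicial join. ($S_T$ is a subcomplex of $\Delta(D)$ and is an $r$-fold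 bipyramid over $\partial\sigma_T$, hence a sphere.) -}

module Defs where

open import Data.Nat using (ℕ)
open import Data.Fin using (Fin)
open import Data.Bool using (Bool; true; false)
open import Data.Empty using (⊥)
open import Data.Product using (Σ; Σ-syntax; _×_)
open import Data.Sum using (_⊎_)
open import Relation.Nullary using (¬_)
open import Relation.Binary.PropositionalEquality using (_≡_; _≢_)

-- A finite directed graph on the vertex set Fin n, given by its edge relation:
-- E x y ≡ true  iff  the directed edge x→y is in E(D).
Graph : ℕ → Set
Graph n = Fin n → Fin n → Bool

-- A set of directed edges on Fin n (e.g. a simplex of Δ(D)); finite since Fin n is.
EdgeSet : ℕ → Set
EdgeSet n = Fin n → Fin n → Bool

VertexSet : ℕ → Set
VertexSet n = Fin n → Bool

_⊆ᴱ_ : ∀ {n} → EdgeSet n → EdgeSet n → Set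
F ⊆ᴱ G = ∀ a b → F a b ≡ true → G a b ≡ true

data Walk {n : ℕ} (F : EdgeSet n) : Fin n → Fin n → Set where
  []   : ∀ {x} → Walk F x x
  step : ∀ {x y z} → F x y ≡ true → Walk F y z → Walk F x z

Acyclic : ∀ {n} → EdgeSet n → Set
Acyclic {n} F = ∀ {x : Fin n} (w : Walk F x x) → w ≡ []

IsDirectedTree : ∀ {n} → EdgeSet n → VertexSet n → Fin n → Set
IsDirectedTree {n} F U r =
  (U r ≡ true)
  × (∀ a b → F a b ≡ true → (U a ≡ true) × (U b ≡ true))
  × Acyclic F
  × (∀ x → U x ≡ true → Σ (Walk F r x) (λ w → ∀ (w' : Walk F r x) → w' ≡ w))

IsDirectedForest : ∀ {n} → EdgeSet n → Set
IsDirectedForest {n} F =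
  Σ ℕ λ k →
  Σ (Fin k → VertexSet n) λ Us →
  Σ (Fin k → EdgeSet n) λ Fs →
  Σ (Fin k → Fin n) λ rs →
    (∀ i → IsDirectedTree (Fs i) (Us i) (rs i))
    × (∀ i j x → i ≢ j → Us i x ≡ true → Us j x ≡ true → ⊥)
    × (∀ a b → F a b ≡ true → Σ (Fin k) λ i → Fs i a b ≡ true)
    × (∀ a b (i : Fin k) → Fs i a b ≡ true → F a b ≡ true)

-- Faces of Δ(D): edge sets of directed forests that are subgraphs of D.
FaceΔ : ∀ {n} → Graph n → EdgeSet n → Set
FaceΔ E F = (F ⊆ᴱ E) × IsDirectedForest F

CompleteSource : ∀ {n} → Graph n → Fin n → Set
CompleteSource E c = ∀ y → y ≢ c → E c y ≡ true

SpanningTree : ∀ {n} → Graph n → EdgeSet n → Fin n → Set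
SpanningTree E T r = (T ⊆ᴱ E) × IsDirectedTree T (λ _ → true) r

IsLeaf : ∀ {n} → EdgeSet n → Fin n → Fin n → Set
IsLeaf T r c = (c ≢ r) × (∀ y → T c y ≡ true → ⊥)

EdgeOn : ∀ {n} {F : EdgeSet n} {x y} → Walk F x y → Fin n → Fin n → Set
EdgeOn []                   a b = ⊥
EdgeOn (step {x} {y} _ w)   a b = ((a ≡ x) × (b ≡ y)) ⊎ EdgeOn w a b

VertexOn : ∀ {n} {F : EdgeSet n} {x y} → Walk F x y → Fin n → Set
VertexOn ([] {x})        v = v ≡ x
VertexOn (step {x} _ w)  v = (v ≡ x) ⊎ VertexOn w v

-- σ_T, where w is the directed path in T from the root r (= x₁) to c:
-- the edges of w together with the edge c→r.
Sigma : ∀ {n} {T : EdgeSet n} {r c : Fin n} → Walk T r c → Fin n → Fin n → Set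
Sigma {r = r} {c = c} w a b = EdgeOn w a b ⊎ ((a ≡ c) × (b ≡ r))

-- G is a face of S_T = ∂σ_T * {z₁y₁, cy₁} * … * {z_ry_r, cy_r}:
--  * every edge of G is in σ_T, or is z_y→y (the T-edge into y) or c→y for a
--    vertex y not on the path w;
--  * G does not contain all of σ_T (the σ_T-part is a proper subset);
--  * for each y off the path, G does not contain both z_y→y and c→y.
InS : ∀ {n} (T : EdgeSet n) (r c : Fin n) → Walk T r c → EdgeSet n → Set
InS T r c w G =
  (∀ a b → G a b ≡ true →
     Sigma w a b ⊎ ((¬ VertexOn w b) × ((T a b ≡ true) ⊎ (a ≡ c))))
  × (¬ (∀ a b → Sigma w a b → G a b ≡ true))
  × (∀ a b → ¬ VertexOn w b → T a b ≡ true → G a b ≡ true → G c b ≡ true → ⊥)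

-- Both inclusions rest on one characterisation of directed forests
-- (`forest-criterion`): an edge set is a directed forest as soon as every
-- vertex has in-degree at most one and some rank μ : vertices → ℕ increases
-- strictly along every edge.  Conversely every directed forest has both
-- properties (module `DirectedForest`).  The components of such an edge set
-- are read off from the root reached by climbing parents (module `Roots`).
--
-- * S_T ⊆ Δ(D) (`S-faces-are-Δ-faces`): a face G of S_T has in-degree ≤ 1
--   because its edges are T-edges, the edge c→r, and for each vertex y off
--   the path at most one of z_y→y, c→y.  Since G misses some edge of the
--   cycle σ_T, cutting the cycle at the head b₀ of that edge gives a rank.
-- * Δ(D) ⊆ ⋃ S_T (`Δ-faces-lie-in-some-S`): given a forest G, remove the
--   edges leaving c, and join the resulting trees into one spanning tree T by
--   edges from the second complete source c'.  Then c is a leaf of T and G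
--   satisfies the three conditions defining a face of S_T.
module Submission where

open import Defs
open import Data.Nat using (ℕ; zero; suc; _+_; _≤_; _<_; z≤n; s≤s)
open import Data.Nat.Properties
  using (≤-pred; <-irrefl; <-≤-trans; ≤-refl; ≤-trans; n<1+n; m≤m+n; +-monoʳ-<; <⇒≤)
open import Data.Fin using (Fin; zero; suc; _≟_)
open import Data.Fin.Properties using (any?)
open import Data.Bool using (Bool; true; false; _∧_; _∨_; not) renaming (_≟_ to _≟ᵇ_)
open import Data.Bool.Properties using (¬-not)
open import Data.Empty using (⊥; ⊥-elim)
open import Data.Product using (Σ; _×_; _,_; proj₁; proj₂)
open import Data.Sum using (_⊎_; inj₁; inj₂)
open import Relation.Nullary using (¬_; Dec; yes; no; does)
open import Relation.Nullary.Decidable using (dec-true; dec-false)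
open import Relation.Binary.PropositionalEquality
  using (_≡_; _≢_; refl; sym; trans; cong; subst; subst₂)
open import Relation.Binary.PropositionalEquality.WithK using (≡-irrelevant)

true≢false : true ≢ false
true≢false ()

∧-elim : ∀ {x y} → x ∧ y ≡ true → (x ≡ true) × (y ≡ true)
∧-elim {true} {true} _ = refl , refl

∧-intro : ∀ {x y} → x ≡ true → y ≡ true → x ∧ y ≡ true
∧-intro refl refl = refl

∨-elim : ∀ {x y} → x ∨ y ≡ true → (x ≡ true) ⊎ (y ≡ true)
∨-elim {true} _ = inj₁ refl
∨-elim {false} p = inj₂ p

∨-introˡ : ∀ {x y} → x ≡ true → x ∨ y ≡ true
∨-introˡ refl = refl

∨-introʳ : ∀ {x y} → y ≡ true → x ∨ y ≡ true
∨-introʳ {true} _ = refl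
∨-introʳ {false} p = p

not-elim : ∀ {x} → not x ≡ true → x ≡ false
not-elim {false} _ = refl

not-intro : ∀ {x} → x ≡ false → not x ≡ true
not-intro refl = refl

_==_ : ∀ {n} → Fin n → Fin n → Bool
a == b = does (a ≟ b)

==⇒≡ : ∀ {n} {a b : Fin n} → a == b ≡ true → a ≡ b
==⇒≡ {a = a} {b} p with a ≟ b
... | yes a≡b = a≡b

≡⇒== : ∀ {n} {a b : Fin n} → a ≡ b → a == b ≡ true
≡⇒== {a = a} {b} = dec-true (a ≟ b)

==-false⇒≢ : ∀ {n} {a b : Fin n} → a == b ≡ false → a ≢ b
==-false⇒≢ {a = a} {b} p a≡b = true≢false (trans (sym (dec-true (a ≟ b) a≡b)) p)

search : ∀ {m} (P : Fin m → Bool) → (Σ (Fin m) λ i → P i ≡ true) ⊎ (∀ i → P i ≡ false)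
search P with any? (λ i → P i ≟ᵇ true)
... | yes found = inj₁ found
... | no none = inj₂ (λ i → ¬-not (λ p → none (i , p)))

move-start : ∀ {n} {F : EdgeSet n} {s s' x} → s ≡ s' → Walk F s x → Walk F s' x
move-start refl w = w

EdgeOn-move-start : ∀ {n} {F : EdgeSet n} {s s' x} (p : s ≡ s') (w : Walk F s x) {a b} →
  EdgeOn (move-start p w) a b → EdgeOn w a b
EdgeOn-move-start refl w on = on

transport : ∀ {n} {F F' : EdgeSet n} {x y} (w : Walk F x y) →
  (∀ a b → EdgeOn w a b → F' a b ≡ true) → Walk F' x y
transport [] h = []
transport (step e w) h = step (h _ _ (inj₁ (refl , refl))) (transport w (λ a b on → h a b (inj₂ on)))

EdgeOn-transport : ∀ {n} {F F' : EdgeSet n} {x y} (w : Walk F x y)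
  (h : ∀ a b → EdgeOn w a b → F' a b ≡ true) {a b} →
  EdgeOn (transport {F' = F'} w h) a b → EdgeOn w a b
EdgeOn-transport (step e w) h (inj₁ p) = inj₁ p
EdgeOn-transport (step e w) h (inj₂ on) = inj₂ (EdgeOn-transport w _ on)

InDegree≤1 : ∀ {n} → EdgeSet n → Set
InDegree≤1 F = ∀ {a a' b} → F a b ≡ true → F a' b ≡ true → a ≡ a'

Ranked : ∀ {n} → EdgeSet n → (Fin n → ℕ) → Set
Ranked F μ = ∀ {a b} → F a b ≡ true → μ a < μ b

NoEdgeInto : ∀ {n} → EdgeSet n → Fin n → Set
NoEdgeInto F x = ∀ a → F a x ≡ false

module Walks {n : ℕ} (F : EdgeSet n) where

  infixr 5 _++_
  _++_ : ∀ {x y z} → Walk F x y → Walk F y z → Walk F x z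
  [] ++ v = v
  step e w ++ v = step e (w ++ v)

  snoc : ∀ {x y z} → Walk F x y → F y z ≡ true → Walk F x z
  snoc w e = w ++ step e []

  length : ∀ {x y} → Walk F x y → ℕ
  length [] = 0
  length (step _ w) = suc (length w)

  length-snoc : ∀ {x y z} (w : Walk F x y) (e : F y z ≡ true) → length (snoc w e) ≡ suc (length w)
  length-snoc [] e = refl
  length-snoc (step _ w) e = cong suc (length-snoc w e)

  ++-identityʳ : ∀ {x y} (w : Walk F x y) → w ++ [] ≡ w
  ++-identityʳ [] = refl
  ++-identityʳ (step e w) = cong (step e) (++-identityʳ w)

  ++-assoc : ∀ {x y z u} (a : Walk F x y) (b : Walk F y z) (c : Walk F z u) → (a ++ b) ++ c ≡ a ++ (b ++ c)
  ++-assoc [] b c = refl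
  ++-assoc (step e a) b c = cong (step e) (++-assoc a b c)

  snoc≢[] : ∀ {x y} (w : Walk F x y) (e : F y x ≡ true) → snoc w e ≢ []
  snoc≢[] [] e ()
  snoc≢[] (step _ _) e ()

  -- The source of the last edge of a walk (the default p if the walk is empty).
  lastSource : Fin n → ∀ {x y} → Walk F x y → Fin n
  lastSource p [] = p
  lastSource p (step {x} _ w) = lastSource x w

  lastSource-snoc : ∀ p {x y z} (w : Walk F x y) (e : F y z ≡ true) → lastSource p (snoc w e) ≡ y
  lastSource-snoc p [] e = refl
  lastSource-snoc p (step e' w) e = lastSource-snoc _ w e

  EdgeOn-++ : ∀ {x y z} (w₁ : Walk F x y) (w₂ : Walk F y z) {a b} →
    EdgeOn (w₁ ++ w₂) a b → EdgeOn w₁ a b ⊎ EdgeOn w₂ a b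
  EdgeOn-++ [] w₂ on = inj₂ on
  EdgeOn-++ (step e w₁) w₂ (inj₁ p) = inj₁ (inj₁ p)
  EdgeOn-++ (step e w₁) w₂ (inj₂ on) with EdgeOn-++ w₁ w₂ on
  ... | inj₁ on₁ = inj₁ (inj₂ on₁)
  ... | inj₂ on₂ = inj₂ on₂

  EdgeOn-++ʳ : ∀ {x y z} (w₁ : Walk F x y) (w₂ : Walk F y z) {a b} →
    EdgeOn w₂ a b → EdgeOn (w₁ ++ w₂) a b
  EdgeOn-++ʳ [] w₂ on = on
  EdgeOn-++ʳ (step e w₁) w₂ on = inj₂ (EdgeOn-++ʳ w₁ w₂ on)

  VertexOn-snoc : ∀ {x y z} (w : Walk F x y) (e : F y z ≡ true) {v} →
    VertexOn (snoc w e) v → VertexOn w v ⊎ v ≡ z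
  VertexOn-snoc [] e (inj₁ p) = inj₁ p
  VertexOn-snoc [] e (inj₂ p) = inj₂ p
  VertexOn-snoc (step e' w) e (inj₁ p) = inj₁ (inj₁ p)
  VertexOn-snoc (step e' w) e (inj₂ on) with VertexOn-snoc w e on
  ... | inj₁ on' = inj₁ (inj₂ on')
  ... | inj₂ p = inj₂ p

  VertexOn-snocˡ : ∀ {x y z} (w : Walk F x y) (e : F y z ≡ true) {v} →
    VertexOn w v → VertexOn (snoc w e) v
  VertexOn-snocˡ [] e p = inj₁ p
  VertexOn-snocˡ (step e' w) e (inj₁ p) = inj₁ p
  VertexOn-snocˡ (step e' w) e (inj₂ on) = inj₂ (VertexOn-snocˡ w e on)

  start-on : ∀ {x y} (w : Walk F x y) → VertexOn w x
  start-on [] = refl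
  start-on (step _ _) = inj₁ refl

  end-on : ∀ {x y} (w : Walk F x y) → VertexOn w y
  end-on [] = refl
  end-on (step _ w) = inj₂ (end-on w)

  EdgeOn⇒edge : ∀ {x y} (w : Walk F x y) {a b} → EdgeOn w a b → F a b ≡ true
  EdgeOn⇒edge (step e w) (inj₁ (refl , refl)) = e
  EdgeOn⇒edge (step e w) (inj₂ on) = EdgeOn⇒edge w on

  EdgeOn⇒source-on : ∀ {x y} (w : Walk F x y) {a b} → EdgeOn w a b → VertexOn w a
  EdgeOn⇒source-on (step e w) (inj₁ (refl , refl)) = inj₁ refl
  EdgeOn⇒source-on (step e w) (inj₂ on) = inj₂ (EdgeOn⇒source-on w on)

  EdgeOn⇒target-on : ∀ {x y} (w : Walk F x y) {a b} → EdgeOn w a b → VertexOn w b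
  EdgeOn⇒target-on (step e w) (inj₁ (refl , refl)) = inj₂ (start-on w)
  EdgeOn⇒target-on (step e w) (inj₂ on) = inj₂ (EdgeOn⇒target-on w on)

  vertexOn? : ∀ {x y} (w : Walk F x y) v → Dec (VertexOn w v)
  vertexOn? {x} [] v = v ≟ x
  vertexOn? {x} (step e w) v with v ≟ x | vertexOn? w v
  ... | yes p | _ = yes (inj₁ p)
  ... | no _ | yes on = yes (inj₂ on)
  ... | no ¬p | no ¬on = no λ { (inj₁ p) → ¬p p ; (inj₂ on) → ¬on on }

  edge-into-walk : InDegree≤1 F → ∀ {x y} (w : Walk F x y) {a b} →
    VertexOn w b → b ≢ x → F a b ≡ true → EdgeOn w a b
  edge-into-walk ind [] on b≢x e = ⊥-elim (b≢x on)
  edge-into-walk ind (step e' w) (inj₁ p) b≢x e = ⊥-elim (b≢x p)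
  edge-into-walk ind (step {y = y} e' w) {a} {b} (inj₂ on) b≢x e with b ≟ y
  ... | yes refl = inj₁ (ind e e' , refl)
  ... | no b≢y = inj₂ (edge-into-walk ind w on b≢y e)

  prefix : ∀ {x y} (w : Walk F x y) {v} → VertexOn w v → Σ (Walk F x v) λ p → length p ≤ length w
  prefix [] refl = [] , z≤n
  prefix (step e w) (inj₁ refl) = [] , z≤n
  prefix (step e w) (inj₂ on) with prefix w on
  ... | p , p≤w = step e p , s≤s p≤w

  missing-edge? : (G : EdgeSet n) → ∀ {x y} (w : Walk F x y) →
    (Σ (Fin n) λ a → Σ (Fin n) λ b → EdgeOn w a b × (G a b ≡ false))
    ⊎ (∀ a b → EdgeOn w a b → G a b ≡ true)
  missing-edge? G [] = inj₂ (λ a b ())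
  missing-edge? G (step {x} {y} e w) with G x y in Gxy | missing-edge? G w
  ... | false | _ = inj₁ (x , y , inj₁ (refl , refl) , Gxy)
  ... | true | inj₁ (a , b , on , Gab) = inj₁ (a , b , inj₂ on , Gab)
  ... | true | inj₂ all = inj₂ λ { a b (inj₁ (refl , refl)) → Gxy ; a b (inj₂ on) → all a b on }

  -- A rank increasing along edges is non-decreasing along walks, so the only
  -- closed walk is the empty one.
  module _ {μ : Fin n → ℕ} (ranked : Ranked F μ) where
    rank-walk : ∀ {x y} → Walk F x y → μ x ≤ μ y
    rank-walk [] = ≤-refl
    rank-walk (step e w) = ≤-trans (<⇒≤ (ranked e)) (rank-walk w)

    ranked⇒acyclic : Acyclic F
    ranked⇒acyclic [] = refl
    ranked⇒acyclic (step e w) = ⊥-elim (<-irrefl refl (<-≤-trans (ranked e) (rank-walk w)))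

  -- Walks viewed from their last edge, used to compare walks with a common
  -- start backwards.
  data SnocWalk : Fin n → Fin n → Set where
    [] : ∀ {x} → SnocWalk x x
    _∷ʳ_ : ∀ {x y z} → SnocWalk x y → F y z ≡ true → SnocWalk x z

  fromSnoc : ∀ {x y} → SnocWalk x y → Walk F x y
  fromSnoc [] = []
  fromSnoc (u ∷ʳ e) = snoc (fromSnoc u) e

  toSnoc : ∀ {x y z} → SnocWalk x y → Walk F y z → SnocWalk x z
  toSnoc acc [] = acc
  toSnoc acc (step e w) = toSnoc (acc ∷ʳ e) w

  fromSnoc-toSnoc : ∀ {x y z} (acc : SnocWalk x y) (w : Walk F y z) →
    fromSnoc (toSnoc acc w) ≡ fromSnoc acc ++ w
  fromSnoc-toSnoc acc [] = sym (++-identityʳ (fromSnoc acc))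
  fromSnoc-toSnoc acc (step e w) =
    trans (fromSnoc-toSnoc (acc ∷ʳ e) w) (++-assoc (fromSnoc acc) (step e []) w)

  -- In a graph of in-degree ≤ 1, walks from a vertex without incoming edges
  -- are unique: peel off last edges, which are forced.
  module _ (ind : InDegree≤1 F) {r : Fin n} (no-edge-into-r : ∀ a → F a r ≡ true → ⊥) where
    unique-snoc : ∀ {x} (u v : SnocWalk r x) → u ≡ v
    unique-snoc [] [] = refl
    unique-snoc [] (v ∷ʳ e) = ⊥-elim (no-edge-into-r _ e)
    unique-snoc (u ∷ʳ e) [] = ⊥-elim (no-edge-into-r _ e)
    unique-snoc (u ∷ʳ e) (v ∷ʳ e') with ind e e'
    ... | refl with ≡-irrelevant e e' | unique-snoc u v
    ...   | refl | refl = refl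

    unique-walk : ∀ {x} (u v : Walk F r x) → u ≡ v
    unique-walk u v =
      trans (sym (fromSnoc-toSnoc [] u))
        (trans (cong fromSnoc (unique-snoc (toSnoc [] u) (toSnoc [] v))) (fromSnoc-toSnoc [] v))

module DirectedTree {n : ℕ} {F : EdgeSet n} {U : VertexSet n} {r : Fin n} (tree : IsDirectedTree F U r) where
  open Walks F

  root-in : U r ≡ true
  root-in = proj₁ tree

  endpoints-in : ∀ a b → F a b ≡ true → (U a ≡ true) × (U b ≡ true)
  endpoints-in = proj₁ (proj₂ tree)

  walk-to : ∀ x → U x ≡ true → Walk F r x
  walk-to x x∈U = proj₁ (proj₂ (proj₂ (proj₂ tree)) x x∈U)

  walk-to-unique : ∀ x (x∈U : U x ≡ true) (w : Walk F r x) → w ≡ walk-to x x∈U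
  walk-to-unique x x∈U = proj₂ (proj₂ (proj₂ (proj₂ tree)) x x∈U)

  walk-to-edge : ∀ {a b} (e : F a b ≡ true) (a∈U : U a ≡ true) (b∈U : U b ≡ true) →
    walk-to b b∈U ≡ snoc (walk-to a a∈U) e
  walk-to-edge e a∈U b∈U = sym (walk-to-unique _ b∈U (snoc (walk-to _ a∈U) e))

  walk-to-root : walk-to r root-in ≡ []
  walk-to-root = sym (walk-to-unique r root-in [])

  in-degree≤1 : InDegree≤1 F
  in-degree≤1 {a} {a'} {b} e e' =
    trans (sym (lastSource-snoc r (walk-to a a∈U) e))
      (trans (cong (lastSource r) (trans (sym (walk-to-edge e a∈U b∈U)) (walk-to-edge e' a'∈U b∈U)))
        (lastSource-snoc r (walk-to a' a'∈U) e'))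
    where
    a∈U : U a ≡ true
    a∈U = proj₁ (endpoints-in a b e)
    b∈U : U b ≡ true
    b∈U = proj₂ (endpoints-in a b e)
    a'∈U : U a' ≡ true
    a'∈U = proj₁ (endpoints-in a' b e')

  no-edge-into-root : ∀ a → F a r ≡ true → ⊥
  no-edge-into-root a e =
    snoc≢[] (walk-to a a∈U) e
      (trans (sym (walk-to-edge e a∈U r∈U))
        (trans (cong (walk-to r) (≡-irrelevant r∈U root-in)) walk-to-root))
    where
    a∈U : U a ≡ true
    a∈U = proj₁ (endpoints-in a r e)
    r∈U : U r ≡ true
    r∈U = proj₂ (endpoints-in a r e)

  depth : ∀ x → U x ≡ true → ℕ
  depth x x∈U = length (walk-to x x∈U)

  depth-edge : ∀ {a b} (e : F a b ≡ true) (a∈U : U a ≡ true) (b∈U : U b ≡ true) →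
    depth b b∈U ≡ suc (depth a a∈U)
  depth-edge e a∈U b∈U = trans (cong length (walk-to-edge e a∈U b∈U)) (length-snoc _ e)

-- A directed forest has in-degree ≤ 1 and is ranked by the depth of each
-- vertex in the (unique) tree containing it.
module DirectedForest {n : ℕ} {F : EdgeSet n} (forest : IsDirectedForest F) where
  private
    k : ℕ
    k = proj₁ forest
    Us : Fin k → VertexSet n
    Us = proj₁ (proj₂ forest)
    Fs : Fin k → EdgeSet n
    Fs = proj₁ (proj₂ (proj₂ forest))
    roots : Fin k → Fin n
    roots = proj₁ (proj₂ (proj₂ (proj₂ forest)))
    trees : ∀ i → IsDirectedTree (Fs i) (Us i) (roots i)
    trees = proj₁ (proj₂ (proj₂ (proj₂ (proj₂ forest))))
    disjoint : ∀ i j x → i ≢ j → Us i x ≡ true → Us j x ≡ true → ⊥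
    disjoint = proj₁ (proj₂ (proj₂ (proj₂ (proj₂ (proj₂ forest)))))
    covered : ∀ a b → F a b ≡ true → Σ (Fin k) λ i → Fs i a b ≡ true
    covered = proj₁ (proj₂ (proj₂ (proj₂ (proj₂ (proj₂ (proj₂ forest))))))
    module Tree (i : Fin k) = DirectedTree (trees i)

    same-tree : ∀ {i j x} → Us i x ≡ true → Us j x ≡ true → i ≡ j
    same-tree {i} {j} x∈i x∈j with i ≟ j
    ... | yes i≡j = i≡j
    ... | no i≢j = ⊥-elim (disjoint i j _ i≢j x∈i x∈j)

  in-degree≤1 : InDegree≤1 F
  in-degree≤1 {a} {a'} {b} e e' with covered a b e | covered a' b e'
  ... | i , eᵢ | j , eⱼ
    with same-tree (proj₂ (Tree.endpoints-in i a b eᵢ)) (proj₂ (Tree.endpoints-in j a' b eⱼ))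
  ...   | refl = Tree.in-degree≤1 i eᵢ eⱼ

  rank : Fin n → ℕ
  rank x with search (λ i → Us i x)
  ... | inj₁ (i , x∈i) = Tree.depth i x x∈i
  ... | inj₂ _ = 0

  rank-is-depth : ∀ i x (x∈i : Us i x ≡ true) → rank x ≡ Tree.depth i x x∈i
  rank-is-depth i x x∈i with search (λ i → Us i x)
  ... | inj₂ nowhere = ⊥-elim (true≢false (trans (sym x∈i) (nowhere i)))
  ... | inj₁ (j , x∈j) with same-tree x∈i x∈j
  ...   | refl with ≡-irrelevant x∈i x∈j
  ...     | refl = refl

  ranked : Ranked F rank
  ranked {a} {b} e with covered a b e
  ... | i , eᵢ =
    subst₂ _<_ (sym (rank-is-depth i a a∈i))
      (sym (trans (rank-is-depth i b b∈i) (Tree.depth-edge i eᵢ a∈i b∈i))) (n<1+n _)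
    where
    a∈i : Us i a ≡ true
    a∈i = proj₁ (Tree.endpoints-in i a b eᵢ)
    b∈i : Us i b ≡ true
    b∈i = proj₂ (Tree.endpoints-in i a b eᵢ)

-- In a ranked graph of in-degree ≤ 1 every vertex x has a root: the vertex
-- without incoming edges reached by climbing parents from x.  The climb
-- terminates because the rank drops at each step, so μ x + 1 steps suffice.
module Roots {n : ℕ} {F : EdgeSet n} (ind : InDegree≤1 F) {μ : Fin n → ℕ} (ranked : Ranked F μ) where
  open Walks F

  Parent : Fin n → Set
  Parent x = (Σ (Fin n) λ a → F a x ≡ true) ⊎ NoEdgeInto F x

  parent? : ∀ x → Parent x
  parent? x = search (λ a → F a x)

  climb : ℕ → Fin n → Fin n
  climb-from : ℕ → (x : Fin n) → Parent x → Fin n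
  climb zero x = x
  climb (suc f) x = climb-from f x (parent? x)
  climb-from f x (inj₁ (a , _)) = climb f a
  climb-from f x (inj₂ _) = x

  climb-reaches-root : ∀ f x → μ x < f → NoEdgeInto F (climb f x) × Walk F (climb f x) x
  climb-from-reaches-root : ∀ f x (p : Parent x) → μ x < suc f →
    NoEdgeInto F (climb-from f x p) × Walk F (climb-from f x p) x
  climb-reaches-root (suc f) x μx<f = climb-from-reaches-root f x (parent? x) μx<f
  climb-from-reaches-root f x (inj₁ (a , e)) μx≤f
    with climb-reaches-root f a (<-≤-trans (ranked e) (≤-pred μx≤f))
  ... | no-edge , w = no-edge , snoc w e
  climb-from-reaches-root f x (inj₂ no-edge) _ = no-edge , []

  climb-fuel : ∀ f f' x → μ x < f → μ x < f' → climb f x ≡ climb f' x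
  climb-from-fuel : ∀ f f' x (p : Parent x) → μ x < suc f → μ x < suc f' →
    climb-from f x p ≡ climb-from f' x p
  climb-fuel (suc f) (suc f') x μx<f μx<f' = climb-from-fuel f f' x (parent? x) μx<f μx<f'
  climb-from-fuel f f' x (inj₁ (a , e)) μx≤f μx≤f' =
    climb-fuel f f' a (<-≤-trans (ranked e) (≤-pred μx≤f)) (<-≤-trans (ranked e) (≤-pred μx≤f'))
  climb-from-fuel f f' x (inj₂ _) _ _ = refl

  root : Fin n → Fin n
  root x = climb (suc (μ x)) x

  root-has-no-parent : ∀ x → NoEdgeInto F (root x)
  root-has-no-parent x = proj₁ (climb-reaches-root (suc (μ x)) x (n<1+n _))

  walk-from-root : ∀ x → Walk F (root x) x
  walk-from-root x = proj₂ (climb-reaches-root (suc (μ x)) x (n<1+n _))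

  root-of-parentless : ∀ {x} → NoEdgeInto F x → root x ≡ x
  root-of-parentless {x} no-edge with parent? x
  ... | inj₁ (a , e) = ⊥-elim (true≢false (trans (sym e) (no-edge a)))
  ... | inj₂ _ = refl

  root-edge : ∀ {a b} → F a b ≡ true → root a ≡ root b
  root-edge {a} {b} e with parent? b
  ... | inj₂ no-edge = ⊥-elim (true≢false (trans (sym e) (no-edge a)))
  ... | inj₁ (a' , e') with ind e' e
  ...   | refl = sym (climb-fuel (μ b) (suc (μ a')) a' (ranked e') (n<1+n _))

  root-idempotent : ∀ x → root (root x) ≡ root x
  root-idempotent x = root-of-parentless (root-has-no-parent x)

  root-along-walk : ∀ {s y} (w : Walk F s y) {a b} → EdgeOn w a b → root b ≡ root s
  root-along-walk (step e w) (inj₁ (refl , refl)) = sym (root-edge e)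
  root-along-walk (step e w) (inj₂ on) = trans (root-along-walk w on) (sym (root-edge e))

  isRoot : Fin n → Bool
  isRoot x with parent? x
  ... | inj₁ _ = false
  ... | inj₂ _ = true

  isRoot⇒parentless : ∀ {x} → isRoot x ≡ true → NoEdgeInto F x
  isRoot⇒parentless {x} p with parent? x
  ... | inj₂ no-edge = no-edge

  parentless⇒isRoot : ∀ {x} → NoEdgeInto F x → isRoot x ≡ true
  parentless⇒isRoot {x} no-edge with parent? x
  ... | inj₁ (a , e) = ⊥-elim (true≢false (trans (sym e) (no-edge a)))
  ... | inj₂ _ = refl

Enumeration : ∀ {n} (P : Fin n → Bool) → Set
Enumeration {n} P =
  Σ ℕ λ k → Σ (Fin k → Fin n) λ e →
    (∀ i → P (e i) ≡ true)
    × (∀ i j → e i ≡ e j → i ≡ j)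
    × (∀ x → P x ≡ true → Σ (Fin k) λ i → e i ≡ x)

suc-injective : ∀ {n} {i j : Fin n} → Fin.suc i ≡ suc j → i ≡ j
suc-injective refl = refl

enumerate : ∀ {n} (P : Fin n → Bool) → Enumeration P
enumerate {zero} P = 0 , (λ ()) , (λ ()) , (λ ()) , (λ ())
enumerate {suc n} P with enumerate (λ i → P (suc i)) | P zero in P0
... | k , e , inP , injective , onto | false =
  k , (λ i → suc (e i)) , inP , (λ i j p → injective i j (suc-injective p)) , onto'
  where
  onto' : ∀ x → P x ≡ true → Σ (Fin k) λ i → suc (e i) ≡ x
  onto' zero p = ⊥-elim (true≢false (trans (sym p) P0))
  onto' (suc x) p with onto x p
  ... | i , q = i , cong suc q
... | k , e , inP , injective , onto | true = suc k , e' , inP' , injective' , onto'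
  where
  e' : Fin (suc k) → Fin (suc n)
  e' zero = zero
  e' (suc i) = suc (e i)
  inP' : ∀ i → P (e' i) ≡ true
  inP' zero = P0
  inP' (suc i) = inP i
  injective' : ∀ i j → e' i ≡ e' j → i ≡ j
  injective' zero zero _ = refl
  injective' (suc i) (suc j) p = cong suc (injective i j (suc-injective p))
  onto' : ∀ x → P x ≡ true → Σ (Fin (suc k)) λ i → e' i ≡ x
  onto' zero _ = zero , refl
  onto' (suc x) p with onto x p
  ... | i , q = suc i , cong suc q

-- Its trees are indexed by the roots; the tree of root ρ consists of the
-- vertices with root ρ and the edges of F entering them.
module ForestCriterion {n : ℕ} {F : EdgeSet n} (ind : InDegree≤1 F)
  {μ : Fin n → ℕ} (ranked : Ranked F μ) where
  open Walks F
  open Roots ind ranked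

  private
    roots : Enumeration isRoot
    roots = enumerate isRoot
    k : ℕ
    k = proj₁ roots
    ρ : Fin k → Fin n
    ρ = proj₁ (proj₂ roots)
    ρ-isRoot : ∀ i → isRoot (ρ i) ≡ true
    ρ-isRoot = proj₁ (proj₂ (proj₂ roots))
    ρ-injective : ∀ i j → ρ i ≡ ρ j → i ≡ j
    ρ-injective = proj₁ (proj₂ (proj₂ (proj₂ roots)))
    ρ-onto : ∀ x → isRoot x ≡ true → Σ (Fin k) λ i → ρ i ≡ x
    ρ-onto = proj₂ (proj₂ (proj₂ (proj₂ roots)))

  Component : Fin k → VertexSet n
  Component i x = root x == ρ i

  ComponentEdges : Fin k → EdgeSet n
  ComponentEdges i a b = F a b ∧ (root b == ρ i)

  component-tree : ∀ i → IsDirectedTree (ComponentEdges i) (Component i) (ρ i)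
  component-tree i =
      ≡⇒== (root-of-parentless ρ-parentless)
    , (λ a b e → let (eF , b∈i) = ∧-elim e in ≡⇒== (trans (root-edge eF) (==⇒≡ b∈i)) , b∈i)
    , Walks.ranked⇒acyclic Fᵢ (λ e → ranked (proj₁ (∧-elim e)))
    , λ x x∈i → walk x x∈i , λ w' → Walks.unique-walk Fᵢ Fᵢ-in-degree≤1 no-edge-into-ρ w' (walk x x∈i)
    where
    Fᵢ : EdgeSet n
    Fᵢ = ComponentEdges i
    Fᵢ-in-degree≤1 : InDegree≤1 Fᵢ
    Fᵢ-in-degree≤1 e e' = ind (proj₁ (∧-elim e)) (proj₁ (∧-elim e'))
    ρ-parentless : NoEdgeInto F (ρ i)
    ρ-parentless = isRoot⇒parentless (ρ-isRoot i)
    no-edge-into-ρ : ∀ a → Fᵢ a (ρ i) ≡ true → ⊥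
    no-edge-into-ρ a e = true≢false (trans (sym (proj₁ (∧-elim e))) (ρ-parentless a))
    walk : ∀ x → Component i x ≡ true → Walk Fᵢ (ρ i) x
    walk x x∈i = move-start (==⇒≡ x∈i) (transport (walk-from-root x) λ a b on →
      ∧-intro (EdgeOn⇒edge (walk-from-root x) on)
        (≡⇒== (trans (root-along-walk (walk-from-root x) on) (trans (root-idempotent x) (==⇒≡ x∈i)))))

  forest : IsDirectedForest F
  forest = k , Component , ComponentEdges , ρ , component-tree
         , (λ i j x i≢j x∈i x∈j →
              i≢j (ρ-injective i j (trans (sym (==⇒≡ {a = root x} x∈i)) (==⇒≡ x∈j))))
         , (λ a b e → let (i , ρi≡) = ρ-onto (root b) (parentless⇒isRoot (root-has-no-parent b))
                      in i , ∧-intro e (≡⇒== (sym ρi≡)))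
         , (λ a b i e → proj₁ (∧-elim e))

forest-criterion : ∀ {n} {F : EdgeSet n} {μ : Fin n → ℕ} →
  InDegree≤1 F → Ranked F μ → IsDirectedForest F
forest-criterion ind ranked = ForestCriterion.forest ind ranked

AllowedInS : ∀ {n} {T : EdgeSet n} {r c : Fin n} → Walk T r c → Fin n → Fin n → Set
AllowedInS {T = T} {c = c} w a b = Sigma w a b ⊎ ((¬ VertexOn w b) × ((T a b ≡ true) ⊎ (a ≡ c)))

module FaceOfS {n : ℕ} {E : Graph n} {c : Fin n} (c-source : CompleteSource E c)
  {T : EdgeSet n} {r : Fin n} (w : Walk T r c) (spanning : SpanningTree E T r) (leaf : IsLeaf T r c)
  {G : EdgeSet n} (face : InS T r c w G) where
  open Walks T
  open DirectedTree (proj₂ spanning)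
    using (walk-to; walk-to-unique; walk-to-edge; depth; depth-edge; no-edge-into-root)
    renaming (in-degree≤1 to T-in-degree≤1)

  private
    G-edges : ∀ a b → G a b ≡ true → AllowedInS w a b
    G-edges = proj₁ face
    σ⊈G : ¬ (∀ a b → Sigma w a b → G a b ≡ true)
    σ⊈G = proj₁ (proj₂ face)
    one-of-two : ∀ a b → ¬ VertexOn w b → T a b ≡ true → G a b ≡ true → G c b ≡ true → ⊥
    one-of-two = proj₂ (proj₂ face)

  W : ∀ x → Walk T r x
  W x = walk-to x refl

  d : Fin n → ℕ
  d x = depth x refl

  w≡W : w ≡ W c
  w≡W = walk-to-unique c refl w

  -- The tree walk to a path vertex is a prefix of w, so it is no deeper than c.
  depth-on-path : ∀ {x} → VertexOn w x → d x ≤ d c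
  depth-on-path {x} on with prefix w on
  ... | p , p≤w =
    subst (λ v → length v ≤ d c) (walk-to-unique x refl p) (subst (λ v → length p ≤ length v) w≡W p≤w)

  Sigma⇒on-path : ∀ {a b} → Sigma w a b → VertexOn w b
  Sigma⇒on-path (inj₁ on) = EdgeOn⇒target-on w on
  Sigma⇒on-path (inj₂ (refl , refl)) = start-on w

  Sigma-in-degree≤1 : ∀ {a a' b} → Sigma w a b → Sigma w a' b → a ≡ a'
  Sigma-in-degree≤1 (inj₁ on) (inj₁ on') = T-in-degree≤1 (EdgeOn⇒edge w on) (EdgeOn⇒edge w on')
  Sigma-in-degree≤1 (inj₁ on) (inj₂ (refl , refl)) = ⊥-elim (no-edge-into-root _ (EdgeOn⇒edge w on))
  Sigma-in-degree≤1 (inj₂ (refl , refl)) (inj₁ on) = ⊥-elim (no-edge-into-root _ (EdgeOn⇒edge w on))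
  Sigma-in-degree≤1 (inj₂ (refl , refl)) (inj₂ (refl , refl)) = refl

  -- Path vertices are entered only by σ_T-edges; off-path vertices by their
  -- T-edge or by c→y, never both.
  in-degree≤1 : InDegree≤1 G
  in-degree≤1 {a} {a'} {b} g g' with G-edges a b g | G-edges a' b g'
  ... | inj₁ s | inj₁ s' = Sigma-in-degree≤1 s s'
  ... | inj₁ s | inj₂ (off , _) = ⊥-elim (off (Sigma⇒on-path s))
  ... | inj₂ (off , _) | inj₁ s' = ⊥-elim (off (Sigma⇒on-path s'))
  ... | inj₂ (off , inj₁ t) | inj₂ (_ , inj₁ t') = T-in-degree≤1 t t'
  ... | inj₂ (off , inj₁ t) | inj₂ (_ , inj₂ refl) = ⊥-elim (one-of-two a b off t g g')
  ... | inj₂ (off , inj₂ refl) | inj₂ (_ , inj₁ t') = ⊥-elim (one-of-two a' b off t' g' g)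
  ... | inj₂ (off , inj₂ refl) | inj₂ (_ , inj₂ refl) = refl

  -- A cut point of the cycle σ_T: a path vertex whose σ_T-edge is missing
  -- from G.  It exists because G does not contain all of σ_T.
  Cut : Set
  Cut = Σ (Fin n) λ b₀ → VertexOn w b₀ × (∀ a → Sigma w a b₀ → G a b₀ ≡ true → ⊥)

  cut : Cut
  cut with G c r in Gcr | missing-edge? G w
  ... | false | _ = r , start-on w , λ
    { a (inj₁ on) _ → no-edge-into-root a (EdgeOn⇒edge w on)
    ; a (inj₂ (refl , _)) g → true≢false (trans (sym g) Gcr) }
  ... | true | inj₁ (a₀ , b₀ , on₀ , Ga₀b₀) = b₀ , EdgeOn⇒target-on w on₀ , λ
    { a (inj₁ on) g → true≢false (trans (sym g)
        (subst (λ x → G x b₀ ≡ false)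
          (T-in-degree≤1 (EdgeOn⇒edge w on₀) (EdgeOn⇒edge w on)) Ga₀b₀))
    ; a (inj₂ (_ , refl)) _ → no-edge-into-root a₀ (EdgeOn⇒edge w on₀) }
  ... | true | inj₂ all = ⊥-elim (σ⊈G λ
    { a b (inj₁ on) → all a b on
    ; a b (inj₂ (refl , refl)) → Gcr })

  b₀ : Fin n
  b₀ = proj₁ cut
  b₀-on-path : VertexOn w b₀
  b₀-on-path = proj₁ (proj₂ cut)
  no-G-edge-into-b₀ : ∀ a → Sigma w a b₀ → G a b₀ ≡ true → ⊥
  no-G-edge-into-b₀ = proj₂ (proj₂ cut)

  -- The rank cuts σ_T open at b₀: path vertices from b₀ on come first (rank
  -- d x), then path vertices before b₀ (rank L + d x), then vertices off the
  -- path (rank 2L + d x), where L exceeds every depth on the path.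
  L : ℕ
  L = suc (d c)

  AfterCut : Fin n → Set
  AfterCut x = VertexOn (W x) b₀

  rank : Fin n → ℕ
  rank x with vertexOn? w x | vertexOn? (W x) b₀
  ... | yes _ | yes _ = d x
  ... | yes _ | no _ = L + d x
  ... | no _ | _ = L + L + d x

  rank-after-cut : ∀ {x} → VertexOn w x → AfterCut x → rank x ≡ d x
  rank-after-cut {x} on after with vertexOn? w x | vertexOn? (W x) b₀
  ... | yes _ | yes _ = refl
  ... | yes _ | no before = ⊥-elim (before after)
  ... | no off | _ = ⊥-elim (off on)

  rank-before-cut : ∀ {x} → VertexOn w x → ¬ AfterCut x → rank x ≡ L + d x
  rank-before-cut {x} on before with vertexOn? w x | vertexOn? (W x) b₀
  ... | yes _ | yes after = ⊥-elim (before after)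
  ... | yes _ | no _ = refl
  ... | no off | _ = ⊥-elim (off on)

  rank-off-path : ∀ {x} → ¬ VertexOn w x → rank x ≡ L + L + d x
  rank-off-path {x} off with vertexOn? w x
  ... | yes on = ⊥-elim (off on)
  ... | no _ = refl

  rank-on-path< : ∀ {x} → VertexOn w x → rank x < L + L
  rank-on-path< {x} on = by-side (vertexOn? (W x) b₀)
    where
    by-side : Dec (AfterCut x) → rank x < L + L
    by-side (yes after) =
      subst (_< L + L) (sym (rank-after-cut on after)) (<-≤-trans (s≤s (depth-on-path on)) (m≤m+n L L))
    by-side (no before) =
      subst (_< L + L) (sym (rank-before-cut on before)) (+-monoʳ-< L (s≤s (depth-on-path on)))

  -- An edge a→b of the path that lies in G does not enter b₀, so a and b lie
  -- on the same side of the cut and the depth increases.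
  rank-path-edge : ∀ {a b} → EdgeOn w a b → G a b ≡ true → rank a < rank b
  rank-path-edge {a} {b} on g = by-side (vertexOn? (W a) b₀)
    where
    e : T a b ≡ true
    e = EdgeOn⇒edge w on
    a-on : VertexOn w a
    a-on = EdgeOn⇒source-on w on
    b-on : VertexOn w b
    b-on = EdgeOn⇒target-on w on
    Wb : W b ≡ snoc (W a) e
    Wb = walk-to-edge e refl refl
    db : d b ≡ suc (d a)
    db = depth-edge e refl refl
    b≢b₀ : b ≢ b₀
    b≢b₀ refl = no-G-edge-into-b₀ a (inj₁ on) g
    by-side : Dec (AfterCut a) → rank a < rank b
    by-side (yes after) =
      subst₂ _<_ (sym (rank-after-cut a-on after)) (sym (trans (rank-after-cut b-on b-after) db)) (n<1+n (d a))
      where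
      b-after : AfterCut b
      b-after = subst (λ v → VertexOn v b₀) (sym Wb) (VertexOn-snocˡ (W a) e after)
    by-side (no before) =
      subst₂ _<_ (sym (rank-before-cut a-on before))
        (sym (trans (rank-before-cut b-on b-before) (cong (L +_) db)))
        (+-monoʳ-< L (n<1+n (d a)))
      where
      b-before : ¬ AfterCut b
      b-before after with VertexOn-snoc (W a) e (subst (λ v → VertexOn v b₀) Wb after)
      ... | inj₁ a-after = before a-after
      ... | inj₂ b₀≡b = b≢b₀ (sym b₀≡b)

  -- If the closing edge c→r is in G, then b₀ ≠ r, so c is after the cut and
  -- r before it.
  rank-closing-edge : G c r ≡ true → rank c < rank r
  rank-closing-edge g =
    subst₂ _<_ (sym (rank-after-cut (end-on w) (subst (λ v → VertexOn v b₀) w≡W b₀-on-path)))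
      (sym (rank-before-cut (start-on w) r-before)) (<-≤-trans (n<1+n (d c)) (m≤m+n L (d r)))
    where
    r-before : ¬ AfterCut r
    r-before after =
      no-G-edge-into-b₀ c (inj₂ (refl , b₀≡r)) (subst (λ v → G c v ≡ true) (sym b₀≡r) g)
      where
      b₀≡r : b₀ ≡ r
      b₀≡r = subst (λ v → VertexOn v b₀) (sym (walk-to-unique r refl [])) after

  -- Off-path vertices are ranked above the whole path and, among
  -- themselves, by depth.
  rank-off-path-edge : ∀ {a b} → ¬ VertexOn w b → (T a b ≡ true) ⊎ (a ≡ c) → rank a < rank b
  rank-off-path-edge {a} {b} b-off source =
    subst (rank a <_) (sym (rank-off-path b-off)) (by-position (vertexOn? w a) source)
    where
    by-position : Dec (VertexOn w a) → (T a b ≡ true) ⊎ (a ≡ c) → rank a < L + L + d b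
    by-position (yes a-on) _ = <-≤-trans (rank-on-path< a-on) (m≤m+n (L + L) (d b))
    by-position (no a-off) (inj₁ t) =
      subst₂ _<_ (sym (rank-off-path a-off)) (cong (L + L +_) (sym (depth-edge t refl refl)))
        (+-monoʳ-< (L + L) (n<1+n (d a)))
    by-position (no a-off) (inj₂ refl) = ⊥-elim (a-off (end-on w))

  ranked : Ranked G rank
  ranked {a} {b} g with G-edges a b g
  ... | inj₁ (inj₁ on) = rank-path-edge on g
  ... | inj₁ (inj₂ (refl , refl)) = rank-closing-edge g
  ... | inj₂ (b-off , source) = rank-off-path-edge b-off source

  -- Edges of G are T-edges or leave the complete source c.
  G⊆E : G ⊆ᴱ E
  G⊆E a b g with G-edges a b g
  ... | inj₁ (inj₁ on) = proj₁ spanning a b (EdgeOn⇒edge w on)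
  ... | inj₁ (inj₂ (refl , refl)) = c-source r (λ r≡c → proj₁ leaf (sym r≡c))
  ... | inj₂ (b-off , inj₁ t) = proj₁ spanning a b t
  ... | inj₂ (b-off , inj₂ refl) = c-source b (λ b≡c → b-off (subst (VertexOn w) (sym b≡c) (end-on w)))

S-faces-are-Δ-faces : ∀ {n} {E : Graph n} {c : Fin n} → CompleteSource E c →
  ∀ {T : EdgeSet n} {r : Fin n} (w : Walk T r c) → SpanningTree E T r → IsLeaf T r c →
  ∀ {G : EdgeSet n} → InS T r c w G → FaceΔ E G
S-faces-are-Δ-faces c-source w spanning leaf face =
  G⊆E , forest-criterion in-degree≤1 ranked
  where open FaceOfS c-source w spanning leaf face

-- Deleting the edges leaving c gives a
-- forest G⁻; its trees are joined into one spanning tree T rooted at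
-- R = root of c', by adding an edge c'→b for every other root b of G⁻.
module FaceOfΔ {n : ℕ} {E : Graph n} {c c' : Fin n} (c≢c' : c ≢ c') (c'-source : CompleteSource E c')
  {G : EdgeSet n} (face : FaceΔ E G) where

  private
    module G = DirectedForest (proj₂ face)

  G⁻ : EdgeSet n
  G⁻ a b = G a b ∧ not (a == c)

  G⁻⇒G : ∀ {a b} → G⁻ a b ≡ true → G a b ≡ true
  G⁻⇒G e = proj₁ (∧-elim e)

  G⁻-source≢c : ∀ {a b} → G⁻ a b ≡ true → a ≢ c
  G⁻-source≢c e = ==-false⇒≢ (not-elim (proj₂ (∧-elim e)))

  G⇒G⁻ : ∀ {a b} → G a b ≡ true → a ≢ c → G⁻ a b ≡ true
  G⇒G⁻ g a≢c = ∧-intro g (not-intro (dec-false (_ ≟ c) a≢c))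

  G⁻-in-degree≤1 : InDegree≤1 G⁻
  G⁻-in-degree≤1 e e' = G.in-degree≤1 (G⁻⇒G e) (G⁻⇒G e')

  G⁻-ranked : Ranked G⁻ G.rank
  G⁻-ranked e = G.ranked (G⁻⇒G e)

  open Roots G⁻-in-degree≤1 G⁻-ranked

  not-into-root : ∀ {x b} → NoEdgeInto G⁻ b → G⁻ x b ≡ true → ⊥
  not-into-root no-edge e = true≢false (trans (sym e) (no-edge _))

  R : Fin n
  R = root c'

  T : EdgeSet n
  T a b = G⁻ a b ∨ ((a == c') ∧ (isRoot b ∧ not (b == R)))

  T-cases : ∀ {a b} → T a b ≡ true → (G⁻ a b ≡ true) ⊎ ((a ≡ c') × NoEdgeInto G⁻ b × (b ≢ R))
  T-cases e with ∨-elim e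
  ... | inj₁ e⁻ = inj₁ e⁻
  ... | inj₂ join = let (a≡c' , rest) = ∧-elim join ; (b-root , b≢R) = ∧-elim rest in
    inj₂ (==⇒≡ a≡c' , isRoot⇒parentless b-root , ==-false⇒≢ (not-elim b≢R))

  G⁻⇒T : ∀ {a b} → G⁻ a b ≡ true → T a b ≡ true
  G⁻⇒T = ∨-introˡ

  joining-edge : ∀ {b} → NoEdgeInto G⁻ b → b ≢ R → T c' b ≡ true
  joining-edge {b} no-edge b≢R =
    ∨-introʳ {x = G⁻ c' b}
      (∧-intro (≡⇒== {a = c'} refl) (∧-intro (parentless⇒isRoot no-edge) (not-intro (dec-false (b ≟ R) b≢R))))

  T-in-degree≤1 : InDegree≤1 T
  T-in-degree≤1 e e' with T-cases e | T-cases e'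
  ... | inj₁ e⁻ | inj₁ e⁻' = G⁻-in-degree≤1 e⁻ e⁻'
  ... | inj₁ e⁻ | inj₂ (_ , no-edge , _) = ⊥-elim (not-into-root no-edge e⁻)
  ... | inj₂ (_ , no-edge , _) | inj₁ e⁻ = ⊥-elim (not-into-root no-edge e⁻)
  ... | inj₂ (refl , _) | inj₂ (refl , _) = refl

  no-T-edge-into-R : ∀ a → T a R ≡ true → ⊥
  no-T-edge-into-R a e with T-cases e
  ... | inj₁ e⁻ = not-into-root (root-has-no-parent c') e⁻
  ... | inj₂ (_ , _ , R≢R) = R≢R refl

  -- T is ranked by shifting the components other than that of R above c'.
  shift : ∀ {x} → Dec (root x ≡ R) → ℕ
  shift (yes _) = 0
  shift (no _) = suc (G.rank c')

  T-rank : Fin n → ℕ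
  T-rank x = shift (root x ≟ R) + G.rank x

  T-ranked : Ranked T T-rank
  T-ranked {a} {b} e with T-cases e
  ... | inj₁ e⁻ = same-component (root a ≟ R) (root b ≟ R)
    where
    same-component : (p : Dec (root a ≡ R)) (q : Dec (root b ≡ R)) → shift p + G.rank a < shift q + G.rank b
    same-component (yes _) (yes _) = G⁻-ranked e⁻
    same-component (no _) (no _) = +-monoʳ-< (suc (G.rank c')) (G⁻-ranked e⁻)
    same-component (yes a-in) (no b-out) = ⊥-elim (b-out (trans (sym (root-edge e⁻)) a-in))
    same-component (no a-out) (yes b-in) = ⊥-elim (a-out (trans (root-edge e⁻) b-in))
  ... | inj₂ (refl , b-root , b≢R) = joined (root c' ≟ R) (root b ≟ R)
    where
    joined : (p : Dec (root c' ≡ R)) (q : Dec (root b ≡ R)) → shift p + G.rank c' < shift q + G.rank b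
    joined (no R≢R) _ = ⊥-elim (R≢R refl)
    joined (yes _) (yes b-in) = ⊥-elim (b≢R (trans (sym (root-of-parentless b-root)) b-in))
    joined (yes _) (no _) = s≤s (m≤m+n (G.rank c') (G.rank b))

  open Walks T

  lift : ∀ {x y} → Walk G⁻ x y → Walk T x y
  lift u = transport u (λ a b on → G⁻⇒T (Walks.EdgeOn⇒edge G⁻ u on))

  EdgeOn-lift : ∀ {x y} (u : Walk G⁻ x y) {a b} → EdgeOn (lift u) a b → G⁻ a b ≡ true
  EdgeOn-lift u on = Walks.EdgeOn⇒edge G⁻ u (EdgeOn-transport u _ on)

  -- The walk in T from R to x: inside the component of R it is the G⁻-walk
  -- from the root; otherwise it goes to c', takes the joining edge to the
  -- root of x, and continues in G⁻.
  walk-via : ∀ x → Dec (root x ≡ R) → Walk T R x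
  walk-via x (yes x-in) = move-start x-in (lift (walk-from-root x))
  walk-via x (no x-out) =
    lift (walk-from-root c') ++ step (joining-edge (root-has-no-parent x) x-out) (lift (walk-from-root x))

  walk-from-R : ∀ x → Walk T R x
  walk-from-R x = walk-via x (root x ≟ R)

  spanning-tree : SpanningTree E T R
  spanning-tree = T⊆E , refl , (λ _ _ _ → refl , refl) , ranked⇒acyclic T-ranked
                , λ x _ → walk-from-R x
                        , λ w' → unique-walk T-in-degree≤1 no-T-edge-into-R w' (walk-from-R x)
    where
    T⊆E : T ⊆ᴱ E
    T⊆E a b e with T-cases e
    ... | inj₁ e⁻ = proj₁ face a b (G⁻⇒G e⁻)
    ... | inj₂ (refl , b-root , b≢R) =
      c'-source b (λ b≡c' → b≢R (trans (sym (root-of-parentless b-root)) (cong root b≡c')))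

  c-is-leaf : IsLeaf T R c
  c-is-leaf = c≢R , no-edge-out-of-c
    where
    c≢R : c ≢ R
    c≢R c≡R with move-start (sym c≡R) (walk-from-root c')
    ... | [] = c≢c' refl
    ... | step e _ = G⁻-source≢c e refl
    no-edge-out-of-c : ∀ y → T c y ≡ true → ⊥
    no-edge-out-of-c y e with T-cases e
    ... | inj₁ e⁻ = G⁻-source≢c e⁻ refl
    ... | inj₂ (c≡c' , _) = c≢c' c≡c'

  w : Walk T R c
  w = walk-from-R c

  path-edges : ∀ {a b} → EdgeOn w a b → (G⁻ a b ≡ true) ⊎ ((a ≡ c') × (b ≡ root c))
  path-edges = by-component (root c ≟ R)
    where
    by-component : ∀ p {a b} → EdgeOn (walk-via c p) a b →
      (G⁻ a b ≡ true) ⊎ ((a ≡ c') × (b ≡ root c))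
    by-component (yes c-in) on = inj₁ (EdgeOn-lift (walk-from-root c) (EdgeOn-move-start c-in _ on))
    by-component (no c-out) on with EdgeOn-++ (lift (walk-from-root c')) _ on
    ... | inj₁ on₁ = inj₁ (EdgeOn-lift (walk-from-root c') on₁)
    ... | inj₂ (inj₁ (refl , refl)) = inj₂ (refl , refl)
    ... | inj₂ (inj₂ on₂) = inj₁ (EdgeOn-lift (walk-from-root c) on₂)

  joining-edge-on-path : root c ≢ R → EdgeOn w c' (root c)
  joining-edge-on-path c-out = on-path (root c ≟ R)
    where
    on-path : ∀ p → EdgeOn (walk-via c p) c' (root c)
    on-path (yes c-in) = ⊥-elim (c-out c-in)
    on-path (no _) = EdgeOn-++ʳ (lift (walk-from-root c')) _ (inj₁ (refl , refl))

  -- G has no edge into the root of c: from a ≠ c it would be a G⁻-edge into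
  -- a root, and from c it would close a cycle with the walk from root c to c.
  no-G-edge-into-root-of-c : ∀ a → G a (root c) ≡ true → ⊥
  no-G-edge-into-root-of-c a g with a ≟ c
  ... | no a≢c = not-into-root (root-has-no-parent c) (G⇒G⁻ g a≢c)
  ... | yes refl = <-irrefl refl (<-≤-trans (G.ranked g) (Walks.rank-walk G⁻ G⁻-ranked (walk-from-root c)))

  -- The head of an edge of G leaving c is a root of G⁻ (in-degree ≤ 1).
  head-of-c-edge-is-root : ∀ {b} → G c b ≡ true → NoEdgeInto G⁻ b
  head-of-c-edge-is-root {b} g x with G⁻ x b in e
  ... | false = refl
  ... | true = ⊥-elim (G⁻-source≢c e (G.in-degree≤1 (G⁻⇒G e) g))

  -- An edge c→b of G with b on the path must be the closing edge c→R:
  -- otherwise b is a root of G⁻ other than R, so the path enters b by its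
  -- joining edge, so b is the root of c.
  edge-from-c-into-path : ∀ {b} → G c b ≡ true → VertexOn w b → b ≡ R
  edge-from-c-into-path {b} g b-on with b ≟ R
  ... | yes b≡R = b≡R
  ... | no b≢R
    with path-edges (edge-into-walk T-in-degree≤1 w b-on b≢R (joining-edge (head-of-c-edge-is-root g) b≢R))
  ...   | inj₁ e⁻ = ⊥-elim (not-into-root (head-of-c-edge-is-root g) e⁻)
  ...   | inj₂ (_ , refl) = ⊥-elim (no-G-edge-into-root-of-c c g)

  edge-into-path : ∀ {a b} → G a b ≡ true → a ≢ c → VertexOn w b → EdgeOn w a b
  edge-into-path {a} {b} g a≢c b-on =
    edge-into-walk T-in-degree≤1 w b-on b≢R t
    where
    t : T a b ≡ true
    t = G⁻⇒T (G⇒G⁻ g a≢c)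
    b≢R : b ≢ R
    b≢R b≡R = no-T-edge-into-R a (subst (λ v → T a v ≡ true) b≡R t)

  edges-of-G : ∀ a b → G a b ≡ true → AllowedInS w a b
  edges-of-G a b g = by-source (a ≟ c) (vertexOn? w b)
    where
    by-source : Dec (a ≡ c) → Dec (VertexOn w b) → AllowedInS w a b
    by-source (yes refl) (yes b-on) = inj₁ (inj₂ (refl , edge-from-c-into-path g b-on))
    by-source (yes a≡c) (no b-off) = inj₂ (b-off , inj₂ a≡c)
    by-source (no a≢c) (yes b-on) = inj₁ (inj₁ (edge-into-path g a≢c b-on))
    by-source (no a≢c) (no b-off) = inj₂ (b-off , inj₁ (G⁻⇒T (G⇒G⁻ g a≢c)))

  -- σ_T ⊈ G: the edge of σ_T into the root of c is missing from G.
  σ-not-in-G : ¬ (∀ a b → Sigma w a b → G a b ≡ true)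
  σ-not-in-G σ⊆G = by-component (root c ≟ R)
    where
    by-component : Dec (root c ≡ R) → ⊥
    by-component (yes c-in) =
      no-G-edge-into-root-of-c c (subst (λ v → G c v ≡ true) (sym c-in) (σ⊆G c R (inj₂ (refl , refl))))
    by-component (no c-out) =
      no-G-edge-into-root-of-c c' (σ⊆G c' (root c) (inj₁ (joining-edge-on-path c-out)))

  one-of-two : ∀ a b → ¬ VertexOn w b → T a b ≡ true → G a b ≡ true → G c b ≡ true → ⊥
  one-of-two a b _ t g g' with G.in-degree≤1 g g'
  ... | refl = proj₂ c-is-leaf b t

  G-in-S : InS T R c w G
  G-in-S = edges-of-G , σ-not-in-G , one-of-two

Δ-faces-lie-in-some-S : ∀ {n} {E : Graph n} {c c' : Fin n} → c ≢ c' → CompleteSource E c' →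
  ∀ {G : EdgeSet n} → FaceΔ E G →
  Σ (EdgeSet n) λ T → Σ (Fin n) λ r → Σ (Walk T r c) λ w →
    SpanningTree E T r × IsLeaf T r c × InS T r c w G
Δ-faces-lie-in-some-S c≢c' c'-source face = T , R , w , spanning-tree , c-is-leaf , G-in-S
  where open FaceOfΔ c≢c' c'-source face

mainTheorem3 : (n : ℕ) (E : Graph n) (c c' : Fin n) →
    c ≢ c' → CompleteSource E c → CompleteSource E c' →
    ((G : EdgeSet n) → FaceΔ E G →
       Σ (EdgeSet n) λ T → Σ (Fin n) λ r → Σ (Walk T r c) λ w →
         SpanningTree E T r × IsLeaf T r c × InS T r c w G)
    × ((T : EdgeSet n) (r : Fin n) (w : Walk T r c) →
         SpanningTree E T r → IsLeaf T r c →
         (G : EdgeSet n) → InS T r c w G → FaceΔ E G)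
mainTheorem3 n E c c' c≢c' c-source c'-source =
    (λ G face → Δ-faces-lie-in-some-S c≢c' c'-source face)
  , (λ T r w spanning leaf G face → S-faces-are-Δ-faces c-source w spanning leaf face)
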